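{- Let $(A,\rightarrow,\rightsquigarrow,1)$ be a pseudo-BE algebra and $D\subseteq A$. Then $D$ is a fantastic deductive system of $A$ if and only if for all $x,y,z\in A$: (1) $1\in D$; (2) $z\rightarrow(y\rightarrow x)\in D$ and $z\in D$ imply $x\vee_1 y\rightarrow x\in D$; (3) $z\rightsquigarrow(y\rightsquigarrow x)\in D$ and $z\in D$ imply $x\vee_2 y\rightsquigarrow x\in D$.
   Context: A pseudo-BE algebra is an algebra $(A,\rightarrow,\rightsquigarrow,1)$ of type $(2,2,0)$ such that for all $x,y,z\in A$: $x\rightarrow x=x\rightsquigarrow x=1$; $x\rightarrow 1=x\rightsquigarrow 1=1$; $1\rightarrow x=1\rightsquigarrow x=x$; $x\rightarrow(y\rightsquigarrow z)=y\rightsquigarrow(x\rightarrow z)$; $x\rightarrow y=1$ iff $x\rightsquigarrow y=1$. Put $x\vee_1 y=(x\rightarrow y)\rightsquigarrow y$ and $x\vee_2 y=(x\rightsquigarrow y)\rightarrow y$. A deductive system of $A$ is $D\subseteq A$ with $1\in D$ such that $x\in D$ and $x\rightarrow y\in D$ imply $y\in D$ (equivalently, $x\in D$ and $x\rightsquigarrow y\in D$ imply $y\in D$). A deductive system $D$ is fantastic if for all $x,y\in A$: $y\rightarrow x\in D$ implies $x\vee_1 y\rightarrow x\in D$, and $y\rightsquigarrow x\in D$ implies $x\vee_2 y\rightsquigarrow x\in D$. Operations are written right-to-left as usual: $x\vee_1 y\rightarrow x$ means $(x\vee_1 y)\rightarrow x$. -}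

module Defs where

open import Level using (Level; _⊔_; suc)
open import Data.Product using (_×_)
open import Relation.Binary.PropositionalEquality using (_≡_)

record PseudoBE (a : Level) : Set (suc a) where
  infixr 5 _⇒_ _⇝_
  field
    Carrier : Set a
    _⇒_     : Carrier → Carrier → Carrier
    _⇝_     : Carrier → Carrier → Carrier
    𝟙       : Carrier
    ⇒-refl  : ∀ x → x ⇒ x ≡ 𝟙
    ⇝-refl  : ∀ x → x ⇝ x ≡ 𝟙
    ⇒-top   : ∀ x → x ⇒ 𝟙 ≡ 𝟙
    ⇝-top   : ∀ x → x ⇝ 𝟙 ≡ 𝟙
    ⇒-unit  : ∀ x → 𝟙 ⇒ x ≡ x
    ⇝-unit  : ∀ x → 𝟙 ⇝ x ≡ x
    exch    : ∀ x y z → x ⇒ (y ⇝ z) ≡ y ⇝ (x ⇒ z)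
    ⇒to⇝    : ∀ x y → x ⇒ y ≡ 𝟙 → x ⇝ y ≡ 𝟙
    ⇝to⇒    : ∀ x y → x ⇝ y ≡ 𝟙 → x ⇒ y ≡ 𝟙

  _∨₁_ : Carrier → Carrier → Carrier
  x ∨₁ y = (x ⇒ y) ⇝ y

  _∨₂_ : Carrier → Carrier → Carrier
  x ∨₂ y = (x ⇝ y) ⇒ y

module _ {a : Level} (A : PseudoBE a) where
  open PseudoBE A

  IsDS : ∀ {ℓ} → (Carrier → Set ℓ) → Set (a ⊔ ℓ)
  IsDS D = D 𝟙 × (∀ x y → D x → D (x ⇒ y) → D y)

  IsFantasticDS : ∀ {ℓ} → (Carrier → Set ℓ) → Set (a ⊔ ℓ)
  IsFantasticDS D =
    IsDS D
    × (∀ x y → D (y ⇒ x) → D ((x ∨₁ y) ⇒ x))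
    × (∀ x y → D (y ⇝ x) → D ((x ∨₂ y) ⇝ x))

module Submission where

-- Two algebraic identities drive the proof: z → ((z ⇝ w) → w) = 1, which
-- shows that a deductive system (defined by modus ponens for →) is also
-- closed under modus ponens for ⇝; and y ∨₁ 1 = 1, so (y ∨₁ 1) → y = y.
-- Forwards: apply modus ponens (for → resp. ⇝) to z and the hypothesis,
-- then the fantastic condition.  Backwards: condition (2) with y := 1
-- yields modus ponens, and conditions (2), (3) with z := 1 yield the
-- fantastic conditions, because 1 → u = u and 1 ⇝ u = u.

open import Defs
open import Level using (Level)
open import Data.Product using (_×_; _,_)
open import Relation.Binary.PropositionalEquality
  using (_≡_; subst; sym; cong; module ≡-Reasoning)

module Identities {a : Level} (A : PseudoBE a) where
  open PseudoBE A
  open ≡-Reasoning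

  ⇝-mp-identity : ∀ z w → z ⇒ ((z ⇝ w) ⇒ w) ≡ 𝟙
  ⇝-mp-identity z w = ⇝to⇒ z ((z ⇝ w) ⇒ w) (begin
    z ⇝ ((z ⇝ w) ⇒ w)   ≡⟨ sym (exch (z ⇝ w) z w) ⟩
    (z ⇝ w) ⇒ (z ⇝ w)   ≡⟨ ⇒-refl (z ⇝ w) ⟩
    𝟙                   ∎)

  ∨₁-𝟙 : ∀ y → y ∨₁ 𝟙 ≡ 𝟙
  ∨₁-𝟙 y = begin
    (y ⇒ 𝟙) ⇝ 𝟙   ≡⟨ ⇝-top (y ⇒ 𝟙) ⟩
    𝟙             ∎

  ∨₁-𝟙-⇒ : ∀ y → (y ∨₁ 𝟙) ⇒ y ≡ y
  ∨₁-𝟙-⇒ y = begin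
    (y ∨₁ 𝟙) ⇒ y   ≡⟨ cong (_⇒ y) (∨₁-𝟙 y) ⟩
    𝟙 ⇒ y          ≡⟨ ⇒-unit y ⟩
    y              ∎

module _ {a ℓ : Level} (A : PseudoBE a) (D : PseudoBE.Carrier A → Set ℓ) where
  open PseudoBE A
  open Identities A

  ⇝-modus-ponens : IsDS A D → ∀ z w → D z → D (z ⇝ w) → D w
  ⇝-modus-ponens (d𝟙 , mp) z w dz dz⇝w =
    mp (z ⇝ w) w dz⇝w (mp z ((z ⇝ w) ⇒ w) dz z-entails)
    where
    z-entails : D (z ⇒ ((z ⇝ w) ⇒ w))
    z-entails = subst D (sym (⇝-mp-identity z w)) d𝟙

  relative⇒modus-ponens :
    (∀ x y z → D (z ⇒ (y ⇒ x)) → D z → D ((x ∨₁ y) ⇒ x)) →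
    ∀ x y → D x → D (x ⇒ y) → D y
  relative⇒modus-ponens cond₂ x y dx dx⇒y =
    subst D (∨₁-𝟙-⇒ y) (cond₂ y 𝟙 x (subst D (cong (x ⇒_) (sym (⇒-unit y))) dx⇒y) dx)

  relative⇒fantastic₁ : D 𝟙 →
    (∀ x y z → D (z ⇒ (y ⇒ x)) → D z → D ((x ∨₁ y) ⇒ x)) →
    ∀ x y → D (y ⇒ x) → D ((x ∨₁ y) ⇒ x)
  relative⇒fantastic₁ d𝟙 cond₂ x y dy⇒x =
    cond₂ x y 𝟙 (subst D (sym (⇒-unit (y ⇒ x))) dy⇒x) d𝟙

  relative⇒fantastic₂ : D 𝟙 →
    (∀ x y z → D (z ⇝ (y ⇝ x)) → D z → D ((x ∨₂ y) ⇝ x)) →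
    ∀ x y → D (y ⇝ x) → D ((x ∨₂ y) ⇝ x)
  relative⇒fantastic₂ d𝟙 cond₃ x y dy⇝x =
    cond₃ x y 𝟙 (subst D (sym (⇝-unit (y ⇝ x))) dy⇝x) d𝟙

proposition5p2 : ∀ {a ℓ : Level} (A : PseudoBE a) (D : PseudoBE.Carrier A → Set ℓ) →
    let open PseudoBE A in
    (IsFantasticDS A D →
      (D 𝟙
       × (∀ x y z → D (z ⇒ (y ⇒ x)) → D z → D ((x ∨₁ y) ⇒ x))
       × (∀ x y z → D (z ⇝ (y ⇝ x)) → D z → D ((x ∨₂ y) ⇝ x))))
    × ((D 𝟙
       × (∀ x y z → D (z ⇒ (y ⇒ x)) → D z → D ((x ∨₁ y) ⇒ x))
       × (∀ x y z → D (z ⇝ (y ⇝ x)) → D z → D ((x ∨₂ y) ⇝ x)))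
      → IsFantasticDS A D)
proposition5p2 A D = fantastic⇒relative , relative⇒fantastic
  where
  open PseudoBE A
  fantastic⇒relative : IsFantasticDS A D →
    D 𝟙
    × (∀ x y z → D (z ⇒ (y ⇒ x)) → D z → D ((x ∨₁ y) ⇒ x))
    × (∀ x y z → D (z ⇝ (y ⇝ x)) → D z → D ((x ∨₂ y) ⇝ x))
  fantastic⇒relative (ds@(d𝟙 , mp) , fant₁ , fant₂) =
    d𝟙
    , (λ x y z h dz → fant₁ x y (mp z (y ⇒ x) dz h))
    , (λ x y z h dz → fant₂ x y (⇝-modus-ponens A D ds z (y ⇝ x) dz h))

  relative⇒fantastic :
    D 𝟙
    × (∀ x y z → D (z ⇒ (y ⇒ x)) → D z → D ((x ∨₁ y) ⇒ x))
    × (∀ x y z → D (z ⇝ (y ⇝ x)) → D z → D ((x ∨₂ y) ⇝ x)) →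
    IsFantasticDS A D
  relative⇒fantastic (d𝟙 , cond₂ , cond₃) =
    (d𝟙 , relative⇒modus-ponens A D cond₂)
    , relative⇒fantastic₁ A D d𝟙 cond₂
    , relative⇒fantastic₂ A D d𝟙 cond₃
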